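{- Let $G=(V,E)$ be a finite simple undirected graph, let $h$ be a positive integer and let $k$ be a positive integer. Then the $(k+1,h)$-truss of $G$ is a subgraph of the $(k,h)$-truss of $G$.
   Context: For vertices $x,y$ of a graph $S$, $\mathrm{dist}_S(x,y)$ denotes the shortest-path distance in $S$. For a vertex $x$ of $S$, $N_S(x,h)=\{y\neq x : \mathrm{dist}_S(x,y)\le h\}$ is the set of $h$-hop neighbors of $x$ in $S$. For an edge $e=(u,v)$ of $S$, the set of common $h$-neighbors of $e$ in $S$ is $\triangle_S(e,h)=N_S(u,h)\cap N_S(v,h)$, and the $h$-support of $e$ in $S$ is $\sup_S(e,h)=|\triangle_S(e,h)|$. A subgraph $S=(V_S,E_S)$ of $G$ has $V_S\subseteq V$ and $E_S\subseteq E$ with all endpoints of edges in $E_S$ lying in $V_S$; $h$-supports in $S$ are computed using distances in $S$. The $(k,h)$-truss of $G$ is the maximal subgraph $S$ of $G$ such that $\sup_S(e,h)\ge k-2$ for every edge $e\in E_S$ (i.e., no proper supergraph of $S$ in $G$ has this property). -}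

module Defs where

open import Data.Nat using (ℕ; zero; suc; _≤_; _∸_)
open import Data.Fin using (Fin; _≟_)
open import Data.Bool using (Bool; true; false; _∧_; _∨_; not; T)
open import Data.List using (List; filterᵇ; length)
open import Data.Bool.ListAction using (any)
open import Data.List using () renaming (allFin to allFinL)
open import Data.Product using (_×_)
open import Relation.Nullary using (¬_)
open import Relation.Nullary.Decidable using (⌊_⌋)
open import Relation.Binary.PropositionalEquality using (_≡_)

record Graph (n : ℕ) : Set where
  field
    adj   : Fin n → Fin n → Bool
    sym   : ∀ x y → adj x y ≡ adj y x
    irrefl : ∀ x → adj x x ≡ false
open Graph public

record Subgraph {n : ℕ} (G : Graph n) : Set where
  field
    vs     : Fin n → Bool
    es     : Fin n → Fin n → Bool
    es-sym : ∀ x y → es x y ≡ es y x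
    es⊆E   : ∀ x y → T (es x y) → T (adj G x y)
    es-ends : ∀ x y → T (es x y) → T (vs x)
open Subgraph public

_⊑_ : ∀ {n} {G : Graph n} → Subgraph G → Subgraph G → Set
S ⊑ S' = (∀ x → T (vs S x) → T (vs S' x)) × (∀ x y → T (es S x y) → T (es S' x y))

-- Closed ball of radius h around x in S: ball S x h y = true iff
-- dist_S(x,y) ≤ h (breadth-first expansion along edges of S).
ball : ∀ {n} {G : Graph n} → Subgraph G → Fin n → ℕ → Fin n → Bool
ball S x zero    y = ⌊ x ≟ y ⌋
ball S x (suc h) y = ball S x h y ∨ any (λ z → ball S x h z ∧ es S z y) (allFinL _)

nbr : ∀ {n} {G : Graph n} → Subgraph G → Fin n → ℕ → Fin n → Bool
nbr S x h y = not ⌊ x ≟ y ⌋ ∧ ball S x h y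

sup : ∀ {n} {G : Graph n} → Subgraph G → Fin n → Fin n → ℕ → ℕ
sup S u v h = length (filterᵇ (λ y → nbr S u h y ∧ nbr S v h y) (allFinL _))

TrussProp : ∀ {n} {G : Graph n} → ℕ → ℕ → Subgraph G → Set
TrussProp k h S = ∀ u v → T (es S u v) → k ∸ 2 ≤ sup S u v h

IsTruss : ∀ {n} (G : Graph n) → ℕ → ℕ → Subgraph G → Set
IsTruss G k h S = TrussProp k h S × (∀ (S' : Subgraph G) → S ⊑ S' → TrussProp k h S' → S' ⊑ S)

{-# OPTIONS --safe #-}
module Submission where

-- Adding edges can only shrink distances, so h-neighbourhoods, and with them
-- h-supports, grow with the edge set. Hence the union of two subgraphs with
-- the (k,h)-truss property has it again, and by maximality the (k,h)-truss
-- contains every subgraph with that property. The (k+1,h)-truss is such a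
-- subgraph, because its supports are at least (k+1) ∸ 2 ≥ k ∸ 2.

open import Defs
open import Data.Nat using (ℕ; _≤_; _+_; _∸_; zero; suc)
open import Data.Nat.Properties using (≤-trans; ∸-monoˡ-≤; m≤m+n)
open import Data.Bool using (Bool; _∧_; _∨_; T)
open import Data.Bool.Properties using (T-∨; T-∧; T?)
open import Data.Bool.ListAction using (any)
open import Data.List using (filterᵇ; length)
open import Data.List using () renaming (allFin to allFinL)
open import Data.List.Relation.Unary.Any as Any using ()
open import Data.List.Relation.Unary.Any.Properties using (any⁺; any⁻)
open import Data.List.Relation.Binary.Sublist.Propositional using (⊆-refl)
open import Data.List.Relation.Binary.Sublist.Propositional.Properties
  using (filter⁺; length-mono-≤)
open import Data.Product as Product using (_,_)
open import Data.Sum as Sum using ([_,_])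
open import Function using (_∘_; id; Equivalence)
open import Relation.Binary.PropositionalEquality using (refl; cong₂)

open Equivalence using (to; from)

∨-map : ∀ {a b c d} → (T a → T c) → (T b → T d) → T (a ∨ b) → T (c ∨ d)
∨-map f g = from T-∨ ∘ Sum.map f g ∘ to T-∨

∧-map : ∀ {a b c d} → (T a → T c) → (T b → T d) → T (a ∧ b) → T (c ∧ d)
∧-map f g = from T-∧ ∘ Product.map f g ∘ to T-∧

any-mono : ∀ {A : Set} {p q : A → Bool} → (∀ x → T (p x) → T (q x)) →
           ∀ xs → T (any p xs) → T (any q xs)
any-mono {p = p} {q} p⇒q xs = any⁺ q ∘ Any.map (p⇒q _) ∘ any⁻ p xs

length-filterᵇ-mono : ∀ {A : Set} {p q : A → Bool} → (∀ x → T (p x) → T (q x)) →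
                      ∀ xs → length (filterᵇ p xs) ≤ length (filterᵇ q xs)
length-filterᵇ-mono {p = p} {q} p⇒q xs =
  length-mono-≤ (filter⁺ (T? ∘ p) (T? ∘ q) (λ { refl → p⇒q _ }) (⊆-refl {x = xs}))

module _ {n : ℕ} {G : Graph n} where

  _⊆ₑ_ : Subgraph G → Subgraph G → Set
  S ⊆ₑ S′ = ∀ x y → T (es S x y) → T (es S′ x y)

  ⊑-trans : {S S′ S″ : Subgraph G} → S ⊑ S′ → S′ ⊑ S″ → S ⊑ S″
  ⊑-trans (vs₁ , es₁) (vs₂ , es₂) = (λ x → vs₂ x ∘ vs₁ x) , (λ x y → es₂ x y ∘ es₁ x y)

  module _ {S S′ : Subgraph G} (S⊆ₑS′ : S ⊆ₑ S′) where

    ball-mono : ∀ x h y → T (ball S x h y) → T (ball S′ x h y)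
    ball-mono x zero    y = id
    ball-mono x (suc h) y =
      ∨-map (ball-mono x h y)
            (any-mono (λ z → ∧-map (ball-mono x h z) (S⊆ₑS′ z y)) (allFinL _))

    nbr-mono : ∀ x h y → T (nbr S x h y) → T (nbr S′ x h y)
    nbr-mono x h y = ∧-map id (ball-mono x h y)

    sup-mono : ∀ u v h → sup S u v h ≤ sup S′ u v h
    sup-mono u v h =
      length-filterᵇ-mono (λ y → ∧-map (nbr-mono u h y) (nbr-mono v h y)) (allFinL _)

  _∪_ : Subgraph G → Subgraph G → Subgraph G
  S ∪ S′ = record
    { vs      = λ x → vs S x ∨ vs S′ x
    ; es      = λ x y → es S x y ∨ es S′ x y
    ; es-sym  = λ x y → cong₂ _∨_ (es-sym S x y) (es-sym S′ x y)
    ; es⊆E    = λ x y → [ es⊆E S x y , es⊆E S′ x y ] ∘ to T-∨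
    ; es-ends = λ x y → ∨-map (es-ends S x y) (es-ends S′ x y)
    }

  S⊑S∪S′ : (S S′ : Subgraph G) → S ⊑ (S ∪ S′)
  S⊑S∪S′ S S′ = (λ x → from T-∨ ∘ Sum.inj₁) , (λ x y → from T-∨ ∘ Sum.inj₁)

  S′⊑S∪S′ : (S S′ : Subgraph G) → S′ ⊑ (S ∪ S′)
  S′⊑S∪S′ S S′ = (λ x → from T-∨ ∘ Sum.inj₂) , (λ x y → from T-∨ ∘ Sum.inj₂)

  TrussProp-antitone : ∀ {k k′ h} {S : Subgraph G} →
                       k ≤ k′ → TrussProp k′ h S → TrussProp k h S
  TrussProp-antitone k≤k′ tr u v e = ≤-trans (∸-monoˡ-≤ 2 k≤k′) (tr u v e)

  TrussProp-∪ : ∀ {k h} {S S′ : Subgraph G} →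
                TrussProp k h S → TrussProp k h S′ → TrussProp k h (S ∪ S′)
  TrussProp-∪ {k} {h} {S} {S′} trS trS′ u v =
    [ via (S⊑S∪S′ S S′) trS , via (S′⊑S∪S′ S S′) trS′ ] ∘ to T-∨
    where
    via : ∀ {R} → R ⊑ (S ∪ S′) → TrussProp k h R → T (es R u v) → k ∸ 2 ≤ sup (S ∪ S′) u v h
    via (_ , R⊆ₑS∪S′) trR e = ≤-trans (trR u v e) (sup-mono R⊆ₑS∪S′ u v h)

  truss-greatest : ∀ {k h} {S U : Subgraph G} →
                   IsTruss G k h U → TrussProp k h S → S ⊑ U
  truss-greatest {k} {h} {S} {U} (trU , maximal) trS =
    ⊑-trans {S} {S ∪ U} {U} (S⊑S∪S′ S U)
            (maximal (S ∪ U) (S′⊑S∪S′ S U) (TrussProp-∪ {k} {h} trS trU))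

lemma1 : ∀ {n : ℕ} (G : Graph n) (h k : ℕ) → 1 ≤ h → 1 ≤ k →
         (S T : Subgraph G) → IsTruss G (k + 1) h S → IsTruss G k h T → S ⊑ T
lemma1 G h k _ _ S T (trS , _) isTrussT =
  truss-greatest {k = k} {h = h} {S} {T} isTrussT
    (TrussProp-antitone {k = k} {h = h} (m≤m+n k 1) trS)
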